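{- For all non-negative integers $\ell\le n$, the number of configurations in $\Omega_n$ having exactly $\ell$ $\times\times$-columns is $$|\Omega^\ell_n|=\frac{\ell+1}{n+1}\binom{2n+2}{n-\ell}.$$
   Context: $\Omega_n$ is the set of pairs of rows (top and bottom) of $n$ cells each, every cell containing a black, a white, or a neutral ($\times$) particle, such that: a top cell contains $\times$ if and only if the bottom cell of the same column contains $\times$ (so neutral particles form $\times\times$-columns); and each maximal run of consecutive columns without $\times$ (between consecutive $\times\times$-columns or borders; runs may be empty) satisfies balance (as many black as white particles in the run, both rows together) and positivity (every initial segment of columns of the run contains at least as many black as white particles). -}

module Defs where

open import Data.Nat using (ℕ; zero; suc)
open import Data.Integer using (ℤ; +_; _+_; _-_; _≤_; _≟_; _≤?_)
open import Data.List using (List; []; _∷_; length; filter; map; concatMap; reverse)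
open import Data.List.Relation.Unary.All using (All; all?)
open import Data.Product using (_×_; _,_)
open import Relation.Binary.PropositionalEquality using (_≡_)
open import Relation.Nullary using (Dec; ¬_; yes; no)
open import Relation.Nullary.Decidable using (_×-dec_; _→-dec_)

-- A particle in a cell: black, white, or neutral (×).
data Particle : Set where
  black white neutral : Particle

-- A column: (top cell, bottom cell).
Column : Set
Column = Particle × Particle

-- A configuration of size n: a list of columns (length n enforced by enumeration below).
Config : Set
Config = List Column

isNeutral : Particle → Set
isNeutral p = p ≡ neutral

isNeutral? : (p : Particle) → Dec (isNeutral p)
isNeutral? black = no (λ ())
isNeutral? white = no (λ ())
isNeutral? neutral = yes _≡_.refl

wt : Particle → ℤ
wt black = + 1
wt white = Data.Integer.-_ (+ 1)
wt neutral = + 0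

colWt : Column → ℤ
colWt (t , b) = wt t + wt b

isXX : Column → Set
isXX (t , b) = isNeutral t × isNeutral b

isXX? : (c : Column) → Dec (isXX c)
isXX? (t , b) = isNeutral? t ×-dec isNeutral? b

ColOK : Column → Set
ColOK (t , b) = (isNeutral t → isNeutral b) × (isNeutral b → isNeutral t)

ColOK? : (c : Column) → Dec (ColOK c)
ColOK? (t , b) = (isNeutral? t →-dec isNeutral? b) ×-dec (isNeutral? b →-dec isNeutral? t)

-- split a list of columns into the maximal runs between ×× columns
-- (runs may be empty; k ×× columns give k+1 runs)
runsFrom : Config → Config → List Config
-- runsFrom cur cs: cur is the (reversed) current run read so far
runsFrom cur [] = reverse cur ∷ []
runsFrom cur (c ∷ cs) with isXX? c
... | yes _ = reverse cur ∷ runsFrom [] cs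
... | no  _ = runsFrom (c ∷ cur) cs

runs : Config → List Config
runs = runsFrom []

total : Config → ℤ
total [] = + 0
total (c ∷ cs) = colWt c + total cs

prefixWts : Config → List ℤ
prefixWts [] = + 0 ∷ []
prefixWts (c ∷ cs) = + 0 ∷ map (λ z → colWt c + z) (prefixWts cs)

Balanced : Config → Set
Balanced r = total r ≡ + 0

Positive : Config → Set
Positive r = All (λ z → + 0 ≤ z) (prefixWts r)

RunOK : Config → Set
RunOK r = Balanced r × Positive r

RunOK? : (r : Config) → Dec (RunOK r)
RunOK? r = (total r ≟ + 0) ×-dec all? (λ z → + 0 ≤? z) (prefixWts r)

InΩ : Config → Set
InΩ cs = All ColOK cs × All RunOK (runs cs)

InΩ? : (cs : Config) → Dec (InΩ cs)
InΩ? cs = all? ColOK? cs ×-dec all? RunOK? (runs cs)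

numXX : Config → ℕ
numXX cs = length (filter isXX? cs)

particles : List Particle
particles = black ∷ white ∷ neutral ∷ []

columns : List Column
columns = concatMap (λ t → map (t ,_) particles) particles

allConfigs : ℕ → List Config
allConfigs zero = [] ∷ []
allConfigs (suc n) = concatMap (λ c → map (c ∷_) (allConfigs n)) columns

Ωnℓ : ℕ → ℕ → List Config
Ωnℓ n ℓ = filter (λ cs → InΩ? cs ×-dec (numXX cs Data.Nat.≟ ℓ)) (allConfigs n)

{-# OPTIONS --safe #-}
module Submission where

-- Read a configuration column by column, keeping the height 2h reached by the current run
-- and the number ℓ of ×× columns still to come. The columns bb, bw, wb, ww move h by
-- +1, 0, 0, −1, and a ×× column is allowed only at h = 0, where it lowers ℓ by one. So h + ℓ
-- performs a bicoloured Motzkin path ending at 0, and the number of valid continuations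
-- depends on h + ℓ only. Pascal's rule applied twice per column gives the reflection formula
-- C(2n+1, n+s+1) − C(2n+1, n+s+2) for these paths from height s, and the absorption identity
-- turns it into (ℓ+1)/(n+1) · C(2n+2, n−ℓ).

open import Defs
open import Data.Bool using (true; false)
open import Data.Empty using (⊥; ⊥-elim)
open import Data.Integer as ℤ using (ℤ; +_; -[1+_]; +≤+)
import Data.Integer.Properties as ℤ
open import Data.List using (List; []; _∷_; length; filter; map; concatMap; reverse; _++_)
open import Data.List.Properties using (length-++; filter-++; filter-none; filter-reject; filter-≐; map-cong; ++-assoc; ++-identityʳ; unfold-reverse)
open import Data.List.Relation.Unary.All as All using (All; []; _∷_; universal)
import Data.List.Relation.Unary.All.Properties as All
open import Data.Maybe using (Maybe; just; nothing; maybe′)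
open import Data.Nat as ℕ using (ℕ; zero; suc; _+_; _*_; _∸_; _≤_; _/_)
open import Data.Nat.Combinatorics using (_C_; nCk+nC[k+1]≡[n+1]C[k+1]; nCk≡nC[n∸k]; nC1≡n)
open import Data.Nat.DivMod using (m*n/n≡m)
open import Data.Nat.ListAction using (sum)
open import Data.Nat.Properties using (suc-injective; +-suc; +-comm; +-identityʳ; +-cancelʳ-≡; *-comm; *-zeroʳ; *-identityˡ; *-identityʳ; *-distribˡ-+; m≤m+n; m+n∸m≡n; m≤n⇒∃[o]m+o≡n)
open import Data.Nat.Tactic.RingSolver using (solve-∀)
open import Data.Product using (_×_; _,_)
open import Function using (_∘_; _⇔_; mk⇔; Equivalence)
open import Relation.Binary.PropositionalEquality
open import Relation.Nullary using (¬_; yes; no; does)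
open import Relation.Nullary.Decidable using (_×-dec_; False; toWitnessFalse)
open import Relation.Unary using (Pred; Decidable; _≐_)
open ≡-Reasoning

module _ {a p} {A : Set a} {P : Pred A p} (P? : Decidable P) where

  count : List A → ℕ
  count = length ∘ filter P?

  count-map : ∀ {b} {B : Set b} (f : B → A) xs → count (map f xs) ≡ length (filter (P? ∘ f) xs)
  count-map f [] = refl
  count-map f (x ∷ xs) with does (P? (f x))
  ... | true  = cong suc (count-map f xs)
  ... | false = count-map f xs

  count-concatMap : ∀ {b} {B : Set b} (f : B → List A) xs → count (concatMap f xs) ≡ sum (map (count ∘ f) xs)
  count-concatMap f [] = refl
  count-concatMap f (x ∷ xs) = begin
    length (filter P? (f x ++ concatMap f xs))             ≡⟨ cong length (filter-++ P? (f x) _) ⟩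
    length (filter P? (f x) ++ filter P? (concatMap f xs)) ≡⟨ length-++ (filter P? (f x)) ⟩
    count (f x) + count (concatMap f xs)                   ≡⟨ cong (λ k → count (f x) + k) (count-concatMap f xs) ⟩
    count (f x) + sum (map (count ∘ f) xs)                 ∎

  count-none : (∀ x → ¬ P x) → ∀ xs → count xs ≡ 0
  count-none ¬P xs = cong length (filter-none P? (universal ¬P xs))

[m+n]Cm≡[m+n]Cn : ∀ m n → (m + n) C m ≡ (m + n) C n
[m+n]Cm≡[m+n]Cn m n = trans (nCk≡nC[n∸k] (m≤m+n m n)) (cong ((m + n) C_) (m+n∸m≡n m n))

pascal² : ∀ n k → suc (suc n) C (2 + k) ≡ n C k + 2 * (n C (1 + k)) + n C (2 + k)
pascal² n k = begin
  suc (suc n) C (2 + k)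
    ≡⟨ nCk+nC[k+1]≡[n+1]C[k+1] (suc n) (1 + k) ⟨
  suc n C (1 + k) + suc n C (2 + k)
    ≡⟨ cong₂ _+_ (nCk+nC[k+1]≡[n+1]C[k+1] n k) (nCk+nC[k+1]≡[n+1]C[k+1] n (1 + k)) ⟨
  (n C k + n C (1 + k)) + (n C (1 + k) + n C (2 + k))
    ≡⟨ lemma (n C k) (n C (1 + k)) (n C (2 + k)) ⟩
  n C k + 2 * (n C (1 + k)) + n C (2 + k)
    ∎
  where
  lemma : ∀ a b c → (a + b) + (b + c) ≡ a + 2 * b + c
  lemma = solve-∀

[k+1]*[n+1]C[k+1]≡[n+1]*nCk : ∀ n k → suc k * (suc n C suc k) ≡ suc n * (n C k)
[k+1]*[n+1]C[k+1]≡[n+1]*nCk zero    zero    = refl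
[k+1]*[n+1]C[k+1]≡[n+1]*nCk zero    (suc k) = *-zeroʳ (2 + k)
[k+1]*[n+1]C[k+1]≡[n+1]*nCk (suc n) zero    = begin
  1 * ((2 + n) C 1) ≡⟨ *-identityˡ ((2 + n) C 1) ⟩
  (2 + n) C 1       ≡⟨ nC1≡n (2 + n) ⟩
  2 + n             ≡⟨ *-identityʳ (2 + n) ⟨
  (2 + n) * 1       ∎
[k+1]*[n+1]C[k+1]≡[n+1]*nCk (suc n) (suc k) = begin
  (2 + k) * ((2 + n) C (2 + k))
    ≡⟨ cong ((2 + k) *_) (nCk+nC[k+1]≡[n+1]C[k+1] (suc n) (suc k)) ⟨
  (2 + k) * (X + Y)
    ≡⟨ lemma₁ k X Y ⟩
  (1 + k) * X + X + (2 + k) * Y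
    ≡⟨ cong₂ (λ a b → a + X + b) ([k+1]*[n+1]C[k+1]≡[n+1]*nCk n k) ([k+1]*[n+1]C[k+1]≡[n+1]*nCk n (suc k)) ⟩
  (1 + n) * (n C k) + X + (1 + n) * (n C (1 + k))
    ≡⟨ lemma₂ n (n C k) (n C (1 + k)) X ⟩
  (1 + n) * (n C k + n C (1 + k)) + X
    ≡⟨ cong (λ a → (1 + n) * a + X) (nCk+nC[k+1]≡[n+1]C[k+1] n k) ⟩
  (1 + n) * X + X
    ≡⟨ lemma₃ n X ⟩
  (2 + n) * X
    ∎
  where
  X = suc n C suc k
  Y = suc n C (2 + k)
  lemma₁ : ∀ k x y → (2 + k) * (x + y) ≡ (1 + k) * x + x + (2 + k) * y
  lemma₁ = solve-∀
  lemma₂ : ∀ n a b x → (1 + n) * a + x + (1 + n) * b ≡ (1 + n) * (a + b) + x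
  lemma₂ = solve-∀
  lemma₃ : ∀ n x → (1 + n) * x + x ≡ (2 + n) * x
  lemma₃ = solve-∀

[k+1]*[k+m]C[k+1]≡m*[k+m]Ck : ∀ k m → suc k * ((k + m) C suc k) ≡ m * ((k + m) C k)
[k+1]*[k+m]C[k+1]≡m*[k+m]Ck k m = +-cancelʳ-≡ (suc k * X) (suc k * A) (m * X) (begin
  suc k * A + suc k * X         ≡⟨ *-distribˡ-+ (suc k) A X ⟨
  suc k * (A + X)               ≡⟨ cong (suc k *_) (trans (+-comm A X) (nCk+nC[k+1]≡[n+1]C[k+1] (k + m) k)) ⟩
  suc k * (suc (k + m) C suc k) ≡⟨ [k+1]*[n+1]C[k+1]≡[n+1]*nCk (k + m) k ⟩
  suc (k + m) * X               ≡⟨ lemma k m X ⟩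
  m * X + suc k * X             ∎)
  where
  A = (k + m) C suc k
  X = (k + m) C k
  lemma : ∀ k m x → suc (k + m) * x ≡ m * x + suc k * x
  lemma = solve-∀

-- Bicoloured Motzkin paths with n steps from height s down to height 0.
biMotzkin : ℕ → ℕ → ℕ
biMotzkin zero    zero    = 1
biMotzkin zero    (suc s) = 0
biMotzkin (suc n) zero    = biMotzkin n 1 + 2 * biMotzkin n 0
biMotzkin (suc n) (suc s) = biMotzkin n (2 + s) + 2 * biMotzkin n (1 + s) + biMotzkin n s

odd : ℕ → ℕ
odd zero    = 1
odd (suc n) = 2 + odd n

odd≡n+[1+n] : ∀ n → odd n ≡ n + suc n
odd≡n+[1+n] zero    = refl
odd≡n+[1+n] (suc n) = trans (cong (suc ∘ suc) (odd≡n+[1+n] n)) (cong suc (sym (+-suc n (suc n))))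

oddC[1+n]≡oddCn : ∀ n → odd n C suc n ≡ odd n C n
oddC[1+n]≡oddCn n rewrite odd≡n+[1+n] n = sym ([m+n]Cm≡[m+n]Cn n (suc n))

sum₁₂₁ : ∀ {a b c p q r t} → a + p ≡ q → b + q ≡ r → c + r ≡ t →
         (a + 2 * b + c) + (r + 2 * q + p) ≡ t + 2 * r + q
sum₁₂₁ {a} {b} {c} {p} refl refl refl = lemma a b c p
  where
  lemma : ∀ a b c p → (a + 2 * b + c) + ((b + (a + p)) + 2 * (a + p) + p)
                    ≡ (c + (b + (a + p))) + 2 * (b + (a + p)) + (a + p)
  lemma = solve-∀

-- The reflection formula in a form valid for all s (both binomials vanish when s > n). At
-- s = 0 the missing down step is compensated by the symmetry C(2n+1, n+1) = C(2n+1, n).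
ballot : ∀ n s → biMotzkin n s + odd n C (2 + (s + n)) ≡ odd n C (1 + (s + n))
ballot zero    zero    = refl
ballot zero    (suc s) = refl
ballot (suc n) zero    = begin
  biMotzkin (suc n) 0 + odd (suc n) C (3 + n)
    ≡⟨ cong₂ _+_ (sym (+-identityʳ _)) (pascal² (odd n) (1 + n)) ⟩
  (biMotzkin n 1 + 2 * biMotzkin n 0 + 0) + (odd n C (1 + n) + 2 * (odd n C (2 + n)) + odd n C (3 + n))
    ≡⟨ sum₁₂₁ {biMotzkin n 1} {p = odd n C (3 + n)} (ballot n 1) (ballot n 0) (oddC[1+n]≡oddCn n) ⟩
  odd n C n + 2 * (odd n C (1 + n)) + odd n C (2 + n)
    ≡⟨ pascal² (odd n) n ⟨
  odd (suc n) C (2 + n)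
    ∎
ballot (suc n) (suc s) rewrite +-suc s n = begin
  biMotzkin (suc n) (suc s) + odd (suc n) C (2 + (2 + j))
    ≡⟨ cong (λ x → biMotzkin (suc n) (suc s) + x) (pascal² (odd n) (2 + j)) ⟩
  biMotzkin (suc n) (suc s) + (odd n C (2 + j) + 2 * (odd n C (3 + j)) + odd n C (4 + j))
    ≡⟨ sum₁₂₁ {biMotzkin n (2 + s)} {p = odd n C (4 + j)} (ballot n (2 + s)) (ballot n (1 + s)) (ballot n s) ⟩
  odd n C (1 + j) + 2 * (odd n C (2 + j)) + odd n C (3 + j)
    ≡⟨ pascal² (odd n) (1 + j) ⟨
  odd (suc n) C (2 + (1 + j))
    ∎
  where j = s + n

ballot-arithmetic : ∀ ℓ m {g a b} → g + b ≡ a → (2 + (ℓ + (ℓ + m))) * b ≡ m * a →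
                    suc (ℓ + m) * g ≡ (ℓ + 1) * (a + b)
ballot-arithmetic ℓ m {g} {b = b} refl absorb = begin
  suc (ℓ + m) * g                  ≡⟨ lemma₁ ℓ m g ⟩
  (ℓ + 1) * g + m * g              ≡⟨ cong (λ x → (ℓ + 1) * g + x) m*g ⟩
  (ℓ + 1) * g + 2 * (ℓ + 1) * b    ≡⟨ lemma₂ ℓ g b ⟩
  (ℓ + 1) * ((g + b) + b)          ∎
  where
  lemma₁ : ∀ ℓ m g → suc (ℓ + m) * g ≡ (ℓ + 1) * g + m * g
  lemma₁ = solve-∀
  lemma₂ : ∀ ℓ g b → (ℓ + 1) * g + 2 * (ℓ + 1) * b ≡ (ℓ + 1) * ((g + b) + b)
  lemma₂ = solve-∀
  lemma₃ : ∀ ℓ m b → (2 + (ℓ + (ℓ + m))) * b ≡ 2 * (ℓ + 1) * b + m * b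
  lemma₃ = solve-∀
  m*g : m * g ≡ 2 * (ℓ + 1) * b
  m*g = +-cancelʳ-≡ (m * b) (m * g) (2 * (ℓ + 1) * b) (begin
    m * g + m * b                  ≡⟨ *-distribˡ-+ m g b ⟨
    m * (g + b)                    ≡⟨ absorb ⟨
    (2 + (ℓ + (ℓ + m))) * b        ≡⟨ lemma₃ ℓ m b ⟩
    2 * (ℓ + 1) * b + m * b        ∎)

biMotzkin-closed-form : ∀ ℓ m → suc (ℓ + m) * biMotzkin (ℓ + m) ℓ ≡ (ℓ + 1) * ((2 * (ℓ + m) + 2) C m)
biMotzkin-closed-form ℓ m = begin
  suc n * biMotzkin n ℓ                     ≡⟨ ballot-arithmetic ℓ m (ballot n ℓ) absorb ⟩
  (ℓ + 1) * (odd n C k + odd n C suc k)     ≡⟨ cong ((ℓ + 1) *_) (nCk+nC[k+1]≡[n+1]C[k+1] (odd n) k) ⟩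
  (ℓ + 1) * (suc (odd n) C suc k)           ≡⟨ cong (λ x → (ℓ + 1) * (suc x C suc k)) k+m≡odd ⟨
  (ℓ + 1) * ((suc k + m) C suc k)           ≡⟨ cong ((ℓ + 1) *_) ([m+n]Cm≡[m+n]Cn (suc k) m) ⟩
  (ℓ + 1) * ((suc k + m) C m)               ≡⟨ cong (λ x → (ℓ + 1) * (x C m)) (lemma₂ ℓ m) ⟩
  (ℓ + 1) * ((2 * n + 2) C m)               ∎
  where
  n = ℓ + m
  k = 1 + (ℓ + n)
  lemma₁ : ∀ ℓ m → 1 + (ℓ + (ℓ + m)) + m ≡ (ℓ + m) + suc (ℓ + m)
  lemma₁ = solve-∀
  lemma₂ : ∀ ℓ m → 2 + (ℓ + (ℓ + m)) + m ≡ 2 * (ℓ + m) + 2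
  lemma₂ = solve-∀
  k+m≡odd : k + m ≡ odd n
  k+m≡odd = trans (lemma₁ ℓ m) (sym (odd≡n+[1+n] n))
  absorb : suc k * (odd n C suc k) ≡ m * (odd n C k)
  absorb = subst (λ N → suc k * (N C suc k) ≡ m * (N C k)) k+m≡odd ([k+1]*[k+m]C[k+1]≡m*[k+m]Ck k m)

firstRun : Config → Config
firstRun [] = []
firstRun (c ∷ cs) with isXX? c
... | yes _ = []
... | no  _ = c ∷ firstRun cs

laterRuns : Config → List Config
laterRuns [] = []
laterRuns (c ∷ cs) with isXX? c
... | yes _ = firstRun cs ∷ laterRuns cs
... | no  _ = laterRuns cs

runsFrom≡ : ∀ cur cs → runsFrom cur cs ≡ (reverse cur ++ firstRun cs) ∷ laterRuns cs
runsFrom≡ cur [] = cong (_∷ []) (sym (++-identityʳ (reverse cur)))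
runsFrom≡ cur (c ∷ cs) with isXX? c
... | yes _ = cong₂ _∷_ (sym (++-identityʳ (reverse cur))) (runsFrom≡ [] cs)
... | no  _ = begin
  runsFrom (c ∷ cur) cs
    ≡⟨ runsFrom≡ (c ∷ cur) cs ⟩
  (reverse (c ∷ cur) ++ firstRun cs) ∷ laterRuns cs
    ≡⟨ cong (λ r → (r ++ firstRun cs) ∷ laterRuns cs) (unfold-reverse c cur) ⟩
  ((reverse cur ++ c ∷ []) ++ firstRun cs) ∷ laterRuns cs
    ≡⟨ cong (_∷ laterRuns cs) (++-assoc (reverse cur) (c ∷ []) (firstRun cs)) ⟩
  (reverse cur ++ c ∷ firstRun cs) ∷ laterRuns cs
    ∎

runs≡ : ∀ cs → runs cs ≡ firstRun cs ∷ laterRuns cs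
runs≡ = runsFrom≡ []

RunFrom : ℤ → Config → Set
RunFrom z r = z ℤ.+ total r ≡ + 0 × All (λ w → + 0 ℤ.≤ z ℤ.+ w) (prefixWts r)

RunFrom? : ∀ z → Decidable (RunFrom z)
RunFrom? z r = (z ℤ.+ total r ℤ.≟ + 0) ×-dec All.all? (λ w → + 0 ℤ.≤? z ℤ.+ w) (prefixWts r)

RunOK⇔RunFrom₀ : ∀ r → RunOK r ⇔ RunFrom (+ 0) r
RunOK⇔RunFrom₀ r = mk⇔
  (λ (balanced , positive) →
    trans (ℤ.+-identityˡ _) balanced , All.map (λ {w} → subst (+ 0 ℤ.≤_) (sym (ℤ.+-identityˡ w))) positive)
  (λ (balanced , positive) →
    trans (sym (ℤ.+-identityˡ _)) balanced , All.map (λ {w} → subst (+ 0 ℤ.≤_) (ℤ.+-identityˡ w)) positive)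

RunFrom-∷ : ∀ {z c r} → + 0 ℤ.≤ z → RunFrom z (c ∷ r) ⇔ RunFrom (z ℤ.+ colWt c) r
RunFrom-∷ {z} {c} {r} 0≤z = mk⇔
  (λ { (balanced , _ ∷ positive) →
    trans (assoc (total r)) balanced ,
    All.map (λ {w} → subst (+ 0 ℤ.≤_) (sym (assoc w))) (All.map⁻ positive) })
  (λ (balanced , positive) →
    trans (sym (assoc (total r))) balanced ,
    subst (+ 0 ℤ.≤_) (sym (ℤ.+-identityʳ z)) 0≤z ∷ All.map⁺ (All.map (λ {w} → subst (+ 0 ℤ.≤_) (assoc w)) positive))
  where
  assoc : ∀ w → z ℤ.+ colWt c ℤ.+ w ≡ z ℤ.+ (colWt c ℤ.+ w)
  assoc = ℤ.+-assoc z (colWt c)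

¬RunFrom-negative : ∀ {k} r → ¬ RunFrom -[1+ k ] r
¬RunFrom-negative []      (_ , () ∷ _)
¬RunFrom-negative (_ ∷ _) (_ , () ∷ _)

State : Set
State = ℕ × ℕ

height : ℕ → ℤ
height h = + (2 * h)

height-suc : ∀ h → height (suc h) ≡ height h ℤ.+ + 2
height-suc h = cong +_ (lemma h)
  where
  lemma : ∀ h → 2 * suc h ≡ 2 * h + 2
  lemma = solve-∀

-- Valid (h , ℓ) cs: cs completes a configuration whose current run has reached weight 2h
-- (proper columns have even weight), and cs contains exactly ℓ ×× columns.
Valid : State → Config → Set
Valid (h , ℓ) cs = All ColOK cs × RunFrom (height h) (firstRun cs) × All RunOK (laterRuns cs) × numXX cs ≡ ℓ

Valid? : ∀ s → Decidable (Valid s)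
Valid? (h , ℓ) cs =
  All.all? ColOK? cs ×-dec RunFrom? (height h) (firstRun cs) ×-dec All.all? RunOK? (laterRuns cs) ×-dec numXX cs ℕ.≟ ℓ

next : Column → State → Maybe State
next (black   , black)   (h     , ℓ)     = just (suc h , ℓ)
next (black   , white)   (h     , ℓ)     = just (h , ℓ)
next (white   , black)   (h     , ℓ)     = just (h , ℓ)
next (white   , white)   (suc h , ℓ)     = just (h , ℓ)
next (neutral , neutral) (zero  , suc ℓ) = just (zero , ℓ)
next _                   _               = nothing

ValidAfter : Maybe State → Config → Set
ValidAfter nothing  _  = ⊥
ValidAfter (just s) cs = Valid s cs

ValidAfter? : ∀ m → Decidable (ValidAfter m)
ValidAfter? nothing  _ = no λ ()
ValidAfter? (just s)   = Valid? s

Valid-∷-proper : ∀ {h h′ ℓ t b cs} → ¬ isNeutral t → ¬ isNeutral b →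
                 height h ℤ.+ colWt (t , b) ≡ height h′ → Valid (h , ℓ) ((t , b) ∷ cs) ⇔ Valid (h′ , ℓ) cs
Valid-∷-proper {h} {t = t} {b} {cs} t≢× b≢× step with isXX? (t , b)
... | yes (t≡× , _) = ⊥-elim (t≢× t≡×)
... | no  ¬×× = mk⇔
  (λ { (_ ∷ ok , run , runs , #××) →
    ok , moveRun step (Equivalence.to (RunFrom-∷ {c = t , b} 0≤height) run) , runs , trans (sym skip) #×× })
  (λ (ok , run , runs , #××) →
    ((⊥-elim ∘ t≢×) , (⊥-elim ∘ b≢×)) ∷ ok ,
    Equivalence.from (RunFrom-∷ {c = t , b} 0≤height) (moveRun (sym step) run) , runs , trans skip #××)
  where
  0≤height : + 0 ℤ.≤ height h
  0≤height = +≤+ ℕ.z≤n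
  moveRun : ∀ {z z′} → z ≡ z′ → RunFrom z (firstRun cs) → RunFrom z′ (firstRun cs)
  moveRun = subst (λ z → RunFrom z (firstRun cs))
  skip : numXX ((t , b) ∷ cs) ≡ numXX cs
  skip = cong length (filter-reject isXX? ¬××)

Valid-∷-×× : ∀ {ℓ cs} → Valid (zero , suc ℓ) ((neutral , neutral) ∷ cs) ⇔ Valid (zero , ℓ) cs
Valid-∷-×× {cs = cs} = mk⇔
  (λ { (_ ∷ ok , _ , run ∷ runs , #××) →
    ok , Equivalence.to (RunOK⇔RunFrom₀ (firstRun cs)) run , runs , suc-injective #×× })
  (λ (ok , run , runs , #××) →
    ((λ _ → refl) , (λ _ → refl)) ∷ ok , (refl , +≤+ ℕ.z≤n ∷ []) ,
    Equivalence.from (RunOK⇔RunFrom₀ (firstRun cs)) run ∷ runs , cong suc #××)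

¬ColOK-∷ : ∀ {s c cs} → False (ColOK? c) → ¬ Valid s (c ∷ cs)
¬ColOK-∷ c✗ (ok ∷ _ , _) = toWitnessFalse c✗ ok

invalid : ∀ {A : Set} → ¬ A → A ⇔ ⊥
invalid ¬a = mk⇔ ¬a ⊥-elim

Valid-∷ : ∀ s c cs → Valid s (c ∷ cs) ⇔ ValidAfter (next c s) cs
Valid-∷ (h , ℓ) (black , black) cs = Valid-∷-proper {h} {suc h} (λ ()) (λ ()) (sym (height-suc h))
Valid-∷ (h , ℓ) (black , white) cs = Valid-∷-proper {h} {h} (λ ()) (λ ()) (ℤ.+-identityʳ (height h))
Valid-∷ (h , ℓ) (white , black) cs = Valid-∷-proper {h} {h} (λ ()) (λ ()) (ℤ.+-identityʳ (height h))
Valid-∷ (suc h , ℓ) (white , white) cs = Valid-∷-proper {suc h} {h} (λ ()) (λ ()) (begin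
  height (suc h) ℤ.+ -[1+ 1 ]          ≡⟨ cong (ℤ._+ -[1+ 1 ]) (height-suc h) ⟩
  height h ℤ.+ + 2 ℤ.+ -[1+ 1 ]        ≡⟨ ℤ.+-assoc (height h) (+ 2) -[1+ 1 ] ⟩
  height h ℤ.+ + 0                     ≡⟨ ℤ.+-identityʳ (height h) ⟩
  height h                             ∎)
Valid-∷ (zero , ℓ) (white , white) cs = invalid λ (_ , run , _) →
  ¬RunFrom-negative (firstRun cs) (Equivalence.to (RunFrom-∷ {c = white , white} (+≤+ ℕ.z≤n)) run)
Valid-∷ (zero , zero) (neutral , neutral) cs = invalid λ ()
Valid-∷ (zero , suc ℓ) (neutral , neutral) cs = Valid-∷-××
Valid-∷ (suc h , ℓ) (neutral , neutral) cs = invalid λ { (_ , (() , _) , _) }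
Valid-∷ s (black   , neutral) cs = invalid (¬ColOK-∷ {s} _)
Valid-∷ s (white   , neutral) cs = invalid (¬ColOK-∷ {s} _)
Valid-∷ s (neutral , black)   cs = invalid (¬ColOK-∷ {s} _)
Valid-∷ s (neutral , white)   cs = invalid (¬ColOK-∷ {s} _)

countValid : ℕ → State → ℕ
countValid n s = count (Valid? s) (allConfigs n)

transfer : (State → ℕ) → State → ℕ
transfer f s = sum (map (λ c → maybe′ f 0 (next c s)) columns)

transfer-cong : ∀ {f g : State → ℕ} → (∀ s → f s ≡ g s) → ∀ s → transfer f s ≡ transfer g s
transfer-cong {f} {g} f≗g s = cong sum (map-cong (λ c → lemma (next c s)) columns)
  where
  lemma : ∀ m → maybe′ f 0 m ≡ maybe′ g 0 m
  lemma nothing  = refl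
  lemma (just s) = f≗g s

countValid-suc : ∀ n s → countValid (suc n) s ≡ transfer (countValid n) s
countValid-suc n s = begin
  count (Valid? s) (concatMap (λ c → map (c ∷_) (allConfigs n)) columns)
    ≡⟨ count-concatMap (Valid? s) (λ c → map (c ∷_) (allConfigs n)) columns ⟩
  sum (map (λ c → count (Valid? s) (map (c ∷_) (allConfigs n))) columns)
    ≡⟨ cong sum (map-cong continue columns) ⟩
  transfer (countValid n) s ∎
  where
  after : ∀ m → count (ValidAfter? m) (allConfigs n) ≡ maybe′ (countValid n) 0 m
  after nothing  = count-none (ValidAfter? nothing) (λ _ ()) (allConfigs n)
  after (just s) = refl
  continue : ∀ c → count (Valid? s) (map (c ∷_) (allConfigs n)) ≡ maybe′ (countValid n) 0 (next c s)
  continue c = begin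
    count (Valid? s) (map (c ∷_) (allConfigs n))       ≡⟨ count-map (Valid? s) (c ∷_) (allConfigs n) ⟩
    length (filter (Valid? s ∘ (c ∷_)) (allConfigs n)) ≡⟨ cong length (filter-≐ _ (ValidAfter? (next c s)) same (allConfigs n)) ⟩
    count (ValidAfter? (next c s)) (allConfigs n)      ≡⟨ after (next c s) ⟩
    maybe′ (countValid n) 0 (next c s)                 ∎
    where
    same : Valid s ∘ (c ∷_) ≐ ValidAfter (next c s)
    same = (λ {cs} → Equivalence.to (Valid-∷ s c cs)) , (λ {cs} → Equivalence.from (Valid-∷ s c cs))

|Ωnℓ|≡countValid : ∀ n ℓ → length (Ωnℓ n ℓ) ≡ countValid n (zero , ℓ)
|Ωnℓ|≡countValid n ℓ = cong length (filter-≐ _ (Valid? (zero , ℓ)) (to , from) (allConfigs n))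
  where
  to : ∀ {cs} → InΩ cs × numXX cs ≡ ℓ → Valid (zero , ℓ) cs
  to {cs} ((ok , runsOK) , #××) with subst (All RunOK) (runs≡ cs) runsOK
  ... | run ∷ runs = ok , Equivalence.to (RunOK⇔RunFrom₀ (firstRun cs)) run , runs , #××
  from : ∀ {cs} → Valid (zero , ℓ) cs → InΩ cs × numXX cs ≡ ℓ
  from {cs} (ok , run , runs , #××) =
    (ok , subst (All RunOK) (sym (runs≡ cs)) (Equivalence.from (RunOK⇔RunFrom₀ (firstRun cs)) run ∷ runs)) , #××

biMotzkin-suc : ∀ n h ℓ → biMotzkin (suc n) (h + ℓ) ≡ transfer (λ (h , ℓ) → biMotzkin n (h + ℓ)) (h , ℓ)
biMotzkin-suc n (suc h) ℓ    = lemma (biMotzkin n (2 + (h + ℓ))) (biMotzkin n (1 + (h + ℓ))) (biMotzkin n (h + ℓ))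
  where
  lemma : ∀ a b c → a + 2 * b + c ≡ a + (b + (0 + (b + (c + (0 + (0 + (0 + (0 + 0))))))))
  lemma = solve-∀
biMotzkin-suc n zero zero    = lemma (biMotzkin n 1) (biMotzkin n 0)
  where
  lemma : ∀ a b → a + 2 * b ≡ a + (b + (0 + (b + (0 + (0 + (0 + (0 + (0 + 0))))))))
  lemma = solve-∀
biMotzkin-suc n zero (suc ℓ) = lemma (biMotzkin n (2 + ℓ)) (biMotzkin n (1 + ℓ)) (biMotzkin n ℓ)
  where
  lemma : ∀ a b c → a + 2 * b + c ≡ a + (b + (0 + (b + (0 + (0 + (0 + (0 + (c + 0))))))))
  lemma = solve-∀

countValid≡biMotzkin : ∀ n h ℓ → countValid n (h , ℓ) ≡ biMotzkin n (h + ℓ)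
countValid≡biMotzkin zero    zero    zero    = refl
countValid≡biMotzkin zero    zero    (suc ℓ) = refl
countValid≡biMotzkin zero    (suc h) ℓ       = refl
countValid≡biMotzkin (suc n) h       ℓ       = begin
  countValid (suc n) (h , ℓ)                         ≡⟨ countValid-suc n (h , ℓ) ⟩
  transfer (countValid n) (h , ℓ)                    ≡⟨ transfer-cong (λ (h , ℓ) → countValid≡biMotzkin n h ℓ) (h , ℓ) ⟩
  transfer (λ (h , ℓ) → biMotzkin n (h + ℓ)) (h , ℓ) ≡⟨ biMotzkin-suc n h ℓ ⟨
  biMotzkin (suc n) (h + ℓ)                          ∎

|Ωnℓ|≡biMotzkin : ∀ n ℓ → length (Ωnℓ n ℓ) ≡ biMotzkin n ℓ
|Ωnℓ|≡biMotzkin n ℓ = trans (|Ωnℓ|≡countValid n ℓ) (countValid≡biMotzkin n zero ℓ)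

lemma6 : (n ℓ : ℕ) → ℓ ≤ n →
    length (Ωnℓ n ℓ) ≡ ((ℓ + 1) * ((2 * n + 2) C (n ∸ ℓ))) / suc n
lemma6 n ℓ ℓ≤n with m≤n⇒∃[o]m+o≡n ℓ≤n
... | m , refl = begin
  length (Ωnℓ n ℓ)                            ≡⟨ |Ωnℓ|≡biMotzkin n ℓ ⟩
  g                                           ≡⟨ m*n/n≡m g (suc n) ⟨
  g * suc n / suc n                           ≡⟨ cong (_/ suc n) (*-comm g (suc n)) ⟩
  suc n * g / suc n                           ≡⟨ cong (_/ suc n) (biMotzkin-closed-form ℓ m) ⟩
  (ℓ + 1) * ((2 * n + 2) C m) / suc n         ≡⟨ cong (λ k → (ℓ + 1) * ((2 * n + 2) C k) / suc n) (m+n∸m≡n ℓ m) ⟨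
  (ℓ + 1) * ((2 * n + 2) C (n ∸ ℓ)) / suc n   ∎
  where
  g = biMotzkin n ℓ
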